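{- Let $\lambda/\mu$ be a skew shape with $r$ rows and $c$ columns, $n=r+c$, $k=c$, and let $\mathcal{I}=(I_1,\dots,I_n)$ be the Grassmann necklace of its rook matroid. Define $$OC(\mathcal{I})=\{(i,c_i+1): i\in[2,n-k],\ c_i<c_{i-1}\},\qquad IC(\mathcal{I})=\{(r_j-1,j-1): j\in[n-k+2,n],\ r_j>r_{j+1},\ r_j\neq1\}.$$ Then $IC(\mathcal{I})$ is the set of inner corners of $\lambda/\mu$ and $OC(\mathcal{I})$ is the set of outer corners of $\lambda/\mu$.
   Context: Rows of $\lambda/\mu$ are labelled $1,\dots,r$ top to bottom, columns $r+1,\dots,r+c$ left to right; the skew shape is the cell set $\{(i,r+j):1\le i\le r,\ \mu_i<j\le\lambda_i\}$, all rows and columns nonempty. Inner corner: a cell $(i,j)\notin\lambda/\mu$ with $(i+1,j),(i,j+1)\in\lambda/\mu$; outer corner: a cell $(i,j)\notin\lambda/\mu$ with $(i,j-1),(i-1,j)\in\lambda/\mu$. The rook matroid is the matroid on $[n]$ with bases $R(\rho)\cup C(\rho)$ ($R$ = occupied rows, $C$ = unoccupied columns) over all non-nesting rook placements $\rho$ (no two rooks in a common row or column, no two $(i,j),(k,\ell)$ with $i<k$, $j<\ell$). Its Grassmann necklace: $I_i$ is the lexicographically smallest basis with respect to the order $i<i+1<\dots<n<1<\dots<i-1$. Notation: $R_i=I_i\cap[1,n-k]$, $r_i=\min R_i$ (for $i\neq n-k+1$), $r_i=0$ for $i\ge n+1$; $C_i=I_i\cap[n-k+1,n]$, $c_i=\max([n-k+1,n]\setminus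 C_i)$. -}

module Defs where

open import Data.Nat using (ℕ; zero; suc; _+_; _∸_; _≤_; _<_; _⊔_)
open import Data.Bool using (Bool; true; false; not)
import Data.Bool
import Data.Nat
import Relation.Nullary
open import Data.List using (List; []; _∷_; _++_; map; upTo; filter; foldr)
open import Data.List.Membership.Propositional using (_∈_)
open import Data.Product using (_×_; _,_; proj₁; proj₂; Σ; ∃; ∃-syntax)
open import Data.Sum using (_⊎_)
open import Relation.Nullary using (¬_)
open import Relation.Binary.PropositionalEquality using (_≡_)
open import Function.Bundles using (_⇔_)

-- Rows are labelled 1..r, columns r+1..r+c.  The partitions λ, μ are
-- given as functions ℕ → ℕ of which only the values at 1..r matter
-- (λ_i = lam i, μ_i = mu i).

record SkewShape : Set where
  field
    r c : ℕ
    lam mu : ℕ → ℕ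
    lam-dec : ∀ i j → 1 ≤ i → i ≤ j → j ≤ r → lam j ≤ lam i
    mu-dec  : ∀ i j → 1 ≤ i → i ≤ j → j ≤ r → mu j ≤ mu i
    row-nonempty : ∀ i → 1 ≤ i → i ≤ r → mu i < lam i
    cols-bounded : ∀ i → 1 ≤ i → i ≤ r → lam i ≤ c
    col-nonempty : ∀ j → 1 ≤ j → j ≤ c →
                   ∃[ i ] (1 ≤ i × i ≤ r × mu i < j × j ≤ lam i)

module _ (S : SkewShape) where
  open SkewShape S

  -- n = r + c, k = c, so n - k = r
  size : ℕ
  size = r + c

  Cell : Set
  Cell = ℕ × ℕ

  InShape : ℕ → ℕ → Set
  InShape a b = 1 ≤ a × a ≤ r × r + mu a < b × b ≤ r + lam a

  InnerCorner : ℕ → ℕ → Set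
  InnerCorner a b = ¬ InShape a b × InShape (suc a) b × InShape a (suc b)

  -- outer corner: (a,b) ∉ λ/μ, (a,b-1) ∈ λ/μ, (a-1,b) ∈ λ/μ
  -- (natural-number subtraction is harmless: no cell has row or column 0)
  OuterCorner : ℕ → ℕ → Set
  OuterCorner a b = ¬ InShape a b × InShape a (b ∸ 1) × InShape (a ∸ 1) b

  NonNesting : List Cell → Set
  NonNesting ρ =
    (∀ x → x ∈ ρ → InShape (proj₁ x) (proj₂ x)) ×
    (∀ x y → x ∈ ρ → y ∈ ρ →
       (proj₁ x ≡ proj₁ y ⊎ proj₂ x ≡ proj₂ y) → x ≡ y) ×
    (∀ x y → x ∈ ρ → y ∈ ρ → ¬ (proj₁ x < proj₁ y × proj₂ x < proj₂ y))

  OccRow : List Cell → ℕ → Set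
  OccRow ρ x = 1 ≤ x × x ≤ r × ∃[ y ] (y ∈ ρ × proj₁ y ≡ x)

  UnoccCol : List Cell → ℕ → Set
  UnoccCol ρ x = r < x × x ≤ size × ¬ (∃[ y ] (y ∈ ρ × proj₂ y ≡ x))

  -- subsets of the ground set [n] = {1..n}, as characteristic functions
  -- (only values on 1..n are relevant)
  SubsetN : Set
  SubsetN = ℕ → Bool

  IsBasis : SubsetN → Set
  IsBasis B = ∃[ ρ ] (NonNesting ρ ×
     (∀ x → 1 ≤ x → x ≤ size → (B x ≡ true ⇔ (OccRow ρ x ⊎ UnoccCol ρ x))))

interval : ℕ → ℕ → List ℕ
interval a b = map (a +_) (upTo (suc b ∸ a))

-- the total order  i < i+1 < … < n < 1 < … < i-1  on [n]
Lt : ℕ → ℕ → ℕ → Set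
Lt i x y = (i ≤ x × i ≤ y × x < y) ⊎ (x < i × y < i × x < y) ⊎ (i ≤ x × y < i)

cycOrder : ℕ → ℕ → List ℕ
cycOrder n i = interval i n ++ interval 1 (i ∸ 1)

data LexLe (_≺_ : ℕ → ℕ → Set) : List ℕ → List ℕ → Set where
  nil  : ∀ {ys} → LexLe _≺_ [] ys
  here : ∀ {x y xs ys} → x ≺ y → LexLe _≺_ (x ∷ xs) (y ∷ ys)
  next : ∀ {x xs ys} → LexLe _≺_ xs ys → LexLe _≺_ (x ∷ xs) (x ∷ ys)

sortedIn : ℕ → ℕ → (ℕ → Bool) → List ℕ
sortedIn n i B = filter (λ x → Data.Bool.T? (B x)) (cycOrder n i)

module _ (S : SkewShape) where
  open SkewShape S

  IsGrassmannNecklace : (ℕ → SubsetN S) → Set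
  IsGrassmannNecklace I =
    ∀ i → 1 ≤ i → i ≤ size S →
      IsBasis S (I i) ×
      (∀ B → IsBasis S B →
         LexLe (Lt i) (sortedIn (size S) i (I i)) (sortedIn (size S) i B))

  headOr0 : List ℕ → ℕ
  headOr0 []      = 0
  headOr0 (x ∷ _) = x

  -- r_i = min R_i = min (I_i ∩ [1, n-k]) ; r_i = 0 for i ≥ n+1.
  -- (R_i is listed increasingly, so its minimum is its first element;
  --  the default 0 for empty R_i is never used where r_i is needed.)
  rr : (ℕ → SubsetN S) → ℕ → ℕ
  rr I i with size S Data.Nat.<? i
  ... | Relation.Nullary.yes _ = 0
  ... | Relation.Nullary.no  _ =
        headOr0 (filter (λ x → Data.Bool.T? (I i x)) (interval 1 r))

  -- c_i = max ([n-k+1, n] \ C_i)   (default 0 if empty)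
  cc : (ℕ → SubsetN S) → ℕ → ℕ
  cc I i = foldr _⊔_ 0
             (filter (λ x → Data.Bool.T? (not (I i x))) (interval (suc r) (size S)))

  InOC : (ℕ → SubsetN S) → ℕ → ℕ → Set
  InOC I a b = ∃[ i ] (2 ≤ i × i ≤ r × cc I i < cc I (i ∸ 1) ×
                       a ≡ i × b ≡ cc I i + 1)

  InIC : (ℕ → SubsetN S) → ℕ → ℕ → Set
  InIC I a b = ∃[ j ] (2 + r ≤ j × j ≤ size S × rr I (suc j) < rr I j ×
                       ¬ (rr I j ≡ 1) × a ≡ rr I j ∸ 1 × b ≡ j ∸ 1)

NecklaceCandidate : SkewShape → Set
NecklaceCandidate S = ℕ → SubsetN S

{-# OPTIONS --safe #-}
-- Each I_j is the basis R(ρ) ∪ C(ρ) of a non-nesting placement ρ, and lexicographic minimality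
-- forbids every modification of ρ that puts a <_j-earlier element into the basis without changing
-- anything before it.  Three modifications suffice: deleting a rook whose column precedes its row
-- in <_j; for a row i, putting a rook on the last cell (i, r + λ_i) and keeping only the rooks
-- below row i; and, for j = b + 1 > r + 1, putting a rook on the first cell of the first row x with
-- r + μ_x < b and keeping only the rooks left of it.  They give c_i = r + λ_i and r_{b+1} = x.
-- Then c_i < c_{i-1} says that row i ends strictly before row i - 1, i.e. (i, c_i + 1) is an outer
-- corner, and r_{b+2} < r_{b+1} ≠ 1 says that row r_{b+1} - 1 starts exactly at column b, i.e.
-- (r_{b+1} - 1, b) is an inner corner.
module Submission where

open import Defs
open import Data.Nat using (ℕ; zero; suc; _+_; _∸_; _≤_; _<_; _⊔_; z≤n; s≤s; s≤s⁻¹)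
open import Data.Nat.Properties
open import Data.Bool using (Bool; true; false; not; T; T?)
open import Data.Bool.Properties using (¬-not)
open import Data.List using (List; _∷_; filter; foldr)
open import Data.List.Membership.Propositional using (_∈_; find; lose)
open import Data.List.Membership.Propositional.Properties
  using (∈-map⁺; ∈-map⁻; ∈-upTo⁺; ∈-upTo⁻; ∈-filter⁺; ∈-filter⁻; ∈-++⁺ˡ; ∈-++⁺ʳ; ∈-++⁻)
open import Data.List.Relation.Binary.Subset.Propositional using (_⊆_)
open import Data.List.Relation.Binary.Subset.Propositional.Properties using (filter-⊆)
open import Data.List.Relation.Unary.Any using (here; there; any?)
open import Data.List.Relation.Unary.All as All using (All; []; _∷_)
open import Data.List.Relation.Unary.AllPairs using (AllPairs; _∷_)
open import Data.List.Relation.Unary.AllPairs.Properties using (map⁺; applyUpTo⁺₁; ++⁺)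
open import Data.Product using (_×_; _,_; proj₁; proj₂; ∃; ∃₂; ∃-syntax)
open import Data.Product.Properties using (≡-dec)
open import Data.Sum using (_⊎_; inj₁; inj₂)
open import Data.Empty using (⊥; ⊥-elim)
open import Data.Unit using (tt)
open import Function using (id; case_of_)
open import Function.Bundles using (_⇔_; mk⇔; Equivalence)
open import Function.Properties.Equivalence using () renaming (sym to ⇔-sym; trans to ⇔-trans)
open import Relation.Nullary using (¬_; Dec; does; yes; no)
open import Relation.Nullary.Decidable using (_×-dec_; _⊎-dec_; ¬?; map′)
open import Relation.Unary using (Decidable)
open import Relation.Binary.Definitions using (Asymmetric; tri<; tri≈; tri>)
open import Relation.Binary.PropositionalEquality
  using (_≡_; _≢_; refl; sym; trans; cong; subst; subst₂)

interval-offset≤ : ∀ a b {i} → i < suc b ∸ a → a + i ≤ b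
interval-offset≤ a b {i} i< with a ≤? suc b
... | yes a≤1+b = s≤s⁻¹ (subst (a + i <_) (m+[n∸m]≡n a≤1+b) (+-monoʳ-< a i<))
... | no a≰1+b = ⊥-elim (n≮0 (subst (i <_) (m≤n⇒m∸n≡0 (<⇒≤ (≰⇒> a≰1+b))) i<))

∈-interval⁻ : ∀ {a b y} → y ∈ interval a b → a ≤ y × y ≤ b
∈-interval⁻ {a} {b} y∈ with ∈-map⁻ (a +_) y∈
... | i , i∈ , refl = m≤m+n a i , interval-offset≤ a b (∈-upTo⁻ i∈)

∈-interval⁺ : ∀ {a b y} → a ≤ y → y ≤ b → y ∈ interval a b
∈-interval⁺ {a} {b} {y} a≤y y≤b =
  subst (_∈ interval a b) (m+[n∸m]≡n a≤y) (∈-map⁺ (a +_) (∈-upTo⁺ (∸-monoˡ-< (s≤s y≤b) a≤y)))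

interval-pairs : ∀ {R : ℕ → ℕ → Set} a b → (∀ {x y} → a ≤ x → x < y → y ≤ b → R x y) →
                 AllPairs R (interval a b)
interval-pairs a b R-inside = map⁺ (applyUpTo⁺₁ id _ (λ {i} i<j j< →
  R-inside (m≤m+n a i) (+-monoʳ-< a i<j) (interval-offset≤ a b j<)))

Lt-asym : ∀ {i} → Asymmetric (Lt i)
Lt-asym (inj₁ (_ , _ , x<y))        (inj₁ (_ , _ , y<x))        = <-asym x<y y<x
Lt-asym (inj₁ (i≤x , _ , _))        (inj₂ (inj₁ (_ , x<i , _))) = <⇒≱ x<i i≤x
Lt-asym (inj₁ (i≤x , _ , _))        (inj₂ (inj₂ (_ , x<i)))     = <⇒≱ x<i i≤x
Lt-asym (inj₂ (inj₁ (x<i , _ , _))) (inj₁ (_ , i≤x , _))        = <⇒≱ x<i i≤x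
Lt-asym (inj₂ (inj₁ (_ , _ , x<y))) (inj₂ (inj₁ (_ , _ , y<x))) = <-asym x<y y<x
Lt-asym (inj₂ (inj₁ (_ , y<i , _))) (inj₂ (inj₂ (i≤y , _)))     = <⇒≱ y<i i≤y
Lt-asym (inj₂ (inj₂ (_ , y<i)))     (inj₁ (i≤y , _ , _))        = <⇒≱ y<i i≤y
Lt-asym (inj₂ (inj₂ (i≤x , _)))     (inj₂ (inj₁ (_ , x<i , _))) = <⇒≱ x<i i≤x
Lt-asym (inj₂ (inj₂ (_ , y<i)))     (inj₂ (inj₂ (i≤y , _)))     = <⇒≱ y<i i≤y

Lt-irrefl : ∀ {i x} → ¬ Lt i x x
Lt-irrefl x<x = Lt-asym x<x x<x

¬Lt-start : ∀ {i y} → ¬ Lt i y i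
¬Lt-start (inj₁ (i≤y , _ , y<i))   = <⇒≱ y<i i≤y
¬Lt-start (inj₂ (inj₁ (_ , i<i , _))) = <-irrefl refl i<i
¬Lt-start (inj₂ (inj₂ (_ , i<i)))     = <-irrefl refl i<i

cycOrder-sorted : ∀ n {i} → 1 ≤ i → AllPairs (Lt i) (cycOrder n i)
cycOrder-sorted n {suc i} _ =
  ++⁺ (interval-pairs (suc i) n (λ i<x x<y _ → inj₁ (i<x , ≤-trans i<x (<⇒≤ x<y) , x<y)))
      (interval-pairs 1 i (λ _ x<y y≤i → inj₂ (inj₁ (<-trans x<y (s≤s y≤i) , s≤s y≤i , x<y))))
      (All.tabulate λ x∈ → All.tabulate λ y∈ →
        inj₂ (inj₂ (proj₁ (∈-interval⁻ x∈) , s≤s (proj₂ (∈-interval⁻ y∈)))))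

∈-cycOrder⁺ : ∀ {n i y} → 1 ≤ y → y ≤ n → y ∈ cycOrder n i
∈-cycOrder⁺ {n} {i} {y} 1≤y y≤n with i ≤? y
... | yes i≤y = ∈-++⁺ˡ (∈-interval⁺ i≤y y≤n)
... | no i≰y  = ∈-++⁺ʳ (interval i n) (∈-interval⁺ 1≤y (<⇒≤pred (≰⇒> i≰y)))

∈-cycOrder⁻ : ∀ {n i y} → 1 ≤ i → i ≤ n → y ∈ cycOrder n i → 1 ≤ y × y ≤ n
∈-cycOrder⁻ {n} {suc i} 1≤i i≤n y∈ with ∈-++⁻ (interval (suc i) n) y∈
... | inj₁ y∈₁ = let (i<y , y≤n) = ∈-interval⁻ y∈₁ in ≤-trans 1≤i i<y , y≤n
... | inj₂ y∈₂ = let (1≤y , y≤i) = ∈-interval⁻ y∈₂ in 1≤y , ≤-trans y≤i (≤-trans (n≤1+n i) i≤n)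

select : (ℕ → Bool) → List ℕ → List ℕ
select B = filter (λ x → T? (B x))

select-nonempty : ∀ B {L z} → z ∈ L → B z ≡ true → ∃₂ λ w ws → select B L ≡ w ∷ ws × w ∈ L
select-nonempty B {h ∷ t} (here refl) Bz with B h | Bz
... | true | refl = h , select B t , refl , here refl
select-nonempty B {h ∷ t} (there z∈t) Bz with B h
... | true  = h , select B t , refl , here refl
... | false with select-nonempty B z∈t Bz
...   | w , ws , eq , w∈t = w , ws , eq , there w∈t

select-first : ∀ B {L x} → AllPairs _<_ L → x ∈ L → B x ≡ true →
               (∀ {y} → y ∈ L → y < x → B y ≡ false) → ∃ λ ys → select B L ≡ x ∷ ys
select-first B {h ∷ t} _ (here refl) Bx _ with B h | Bx
... | true | refl = select B t , refl
select-first B {h ∷ t} (h<t ∷ t-sorted) (there x∈t) Bx below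
  with B h | below (here refl) (All.lookup h<t x∈t)
... | false | refl = select-first B t-sorted x∈t Bx (λ y∈t → below (there y∈t))

foldr-⊔-≡ : ∀ {m L} → m ∈ L → All (_≤ m) L → foldr _⊔_ 0 L ≡ m
foldr-⊔-≡ (here refl)  (_ ∷ t≤m)   = m≥n⇒m⊔n≡m (foldr-⊔-≤ t≤m)
  where
  foldr-⊔-≤ : ∀ {m L} → All (_≤ m) L → foldr _⊔_ 0 L ≤ m
  foldr-⊔-≤ []           = z≤n
  foldr-⊔-≤ (h≤m ∷ t≤m) = ⊔-lub h≤m (foldr-⊔-≤ t≤m)
foldr-⊔-≡ (there m∈t) (h≤m ∷ t≤m) rewrite foldr-⊔-≡ m∈t t≤m = m≤n⇒m⊔n≡n h≤m

does≡true⇔ : ∀ {P : Set} (P? : Dec P) → does P? ≡ true ⇔ P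
does≡true⇔ (yes p) = mk⇔ (λ _ → p) (λ _ → refl)
does≡true⇔ (no ¬p) = mk⇔ (λ ()) (λ p → ⊥-elim (¬p p))

≡true⇔⇒≡ : ∀ {b c : Bool} → (b ≡ true ⇔ c ≡ true) → b ≡ c
≡true⇔⇒≡ {true}  {true}  _ = refl
≡true⇔⇒≡ {false} {false} _ = refl
≡true⇔⇒≡ {true}  {false} b⇔c = sym (Equivalence.to b⇔c refl)
≡true⇔⇒≡ {false} {true}  b⇔c = Equivalence.from b⇔c refl

module _ {_≺_ : ℕ → ℕ → Set} (≺-asym : Asymmetric _≺_) where

  private
    LexLe-tail : ∀ {x xs ys} → LexLe _≺_ (x ∷ xs) (x ∷ ys) → LexLe _≺_ xs ys
    LexLe-tail (here x≺x) = ⊥-elim (≺-asym x≺x x≺x)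
    LexLe-tail (next le)  = le

    ¬LexLe-head : ∀ {w h ws ys} → h ≺ w → ¬ LexLe _≺_ (w ∷ ws) (h ∷ ys)
    ¬LexLe-head h≺w (here w≺h) = ≺-asym h≺w w≺h
    ¬LexLe-head h≺h (next _)   = ≺-asym h≺h h≺h

  -- Without the later element z of B, select B L could be a proper prefix of select B' L.
  select-¬LexLe : ∀ {L} → AllPairs _≺_ L → ∀ B B' {x z} → x ∈ L → z ∈ L → x ≺ z →
                  (∀ {y} → y ∈ L → y ≺ x → B y ≡ B' y) →
                  B x ≡ false → B' x ≡ true → B z ≡ true →
                  ¬ LexLe _≺_ (select B L) (select B' L)
  select-¬LexLe _ B B' (here refl) (here refl) x≺x _ _ _ _ _ = ≺-asym x≺x x≺x
  select-¬LexLe {h ∷ _} (h≺t ∷ _) B B' (here refl) (there z∈t) _ _ Bx B'x Bz le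
    with select-nonempty B z∈t Bz
  ... | w , ws , eq , w∈t with B h | Bx | B' h | B'x
  ...   | false | refl | true | refl rewrite eq = ¬LexLe-head (All.lookup h≺t w∈t) le
  select-¬LexLe (h≺t ∷ _) B B' (there x∈t) (here refl) x≺h _ _ _ _ _ = ≺-asym x≺h (All.lookup h≺t x∈t)
  select-¬LexLe {h ∷ t} (h≺t ∷ t-sorted) B B' (there x∈t) (there z∈t) x≺z agree Bx B'x Bz le
    with B h | B' h | agree (here refl) (All.lookup h≺t x∈t)
  ... | true | true | _ =
    select-¬LexLe t-sorted B B' x∈t z∈t x≺z (λ y∈t → agree (there y∈t)) Bx B'x Bz (LexLe-tail le)
  ... | false | false | _ =
    select-¬LexLe t-sorted B B' x∈t z∈t x≺z (λ y∈t → agree (there y∈t)) Bx B'x Bz le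

module _ {P : ℕ → Set} (P? : Decidable P) where

  private
    search : ∀ m → (∃[ x ] (x < m × P x × ∀ {y} → y < x → ¬ P y)) ⊎ (∀ {y} → y < m → ¬ P y)
    search zero = inj₂ λ ()
    search (suc m) with search m | P? m
    ... | inj₁ (x , x<m , Px , least) | _ = inj₁ (x , m<n⇒m<1+n x<m , Px , least)
    ... | inj₂ none | yes Pm = inj₁ (m , ≤-refl , Pm , none)
    ... | inj₂ none | no ¬Pm = inj₂ λ y<1+m → case m≤n⇒m<n∨m≡n (s≤s⁻¹ y<1+m) of λ
      { (inj₁ y<m) → none y<m
      ; (inj₂ refl) → ¬Pm }

  least-witness : ∀ {m} → P m → ∃[ x ] (x ≤ m × P x × ∀ {y} → y < x → ¬ P y)
  least-witness {m} Pm with search (suc m)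
  ... | inj₁ (x , x<1+m , Px , least) = x , s≤s⁻¹ x<1+m , Px , least
  ... | inj₂ none = ⊥-elim (none ≤-refl Pm)

module Shape (S : SkewShape) where
  open SkewShape S

  rowStart rowEnd : ℕ → ℕ
  rowStart a = r + mu a
  rowEnd a = r + lam a

  module _ {a : ℕ} (1≤a : 1 ≤ a) (a≤r : a ≤ r) where

    rowStart<rowEnd : rowStart a < rowEnd a
    rowStart<rowEnd = +-monoʳ-< r (row-nonempty a 1≤a a≤r)

    rowEnd≤n : rowEnd a ≤ size S
    rowEnd≤n = +-monoʳ-≤ r (cols-bounded a 1≤a a≤r)

    rowEnd-antitone : ∀ {a'} → a ≤ a' → a' ≤ r → rowEnd a' ≤ rowEnd a
    rowEnd-antitone a≤a' a'≤r = +-monoʳ-≤ r (lam-dec a _ 1≤a a≤a' a'≤r)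

  rowStart-antitone : ∀ {a a'} → 1 ≤ a → a ≤ a' → a' ≤ r → rowStart a' ≤ rowStart a
  rowStart-antitone 1≤a a≤a' a'≤r = +-monoʳ-≤ r (mu-dec _ _ 1≤a a≤a' a'≤r)

  inShape-r< : ∀ {a b} → InShape S a b → r < b
  inShape-r< {a} (_ , _ , start<b , _) = ≤-<-trans (m≤m+n r (mu a)) start<b

  inShape-≤n : ∀ {a b} → InShape S a b → b ≤ size S
  inShape-≤n (1≤a , a≤r , _ , b≤end) = ≤-trans b≤end (rowEnd≤n 1≤a a≤r)

  covering-row : ∀ {b} → r < b → b ≤ size S → ∃[ a ] InShape S a b
  covering-row {b} r<b b≤n with col-nonempty (b ∸ r) (m<n⇒0<n∸m r<b) (m≤n+o⇒m∸n≤o b r b≤n)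
  ... | a , 1≤a , a≤r , mu<b-r , b-r≤lam =
    a , 1≤a , a≤r , subst (rowStart a <_) r+[b-r]≡b (+-monoʳ-< r mu<b-r) ,
                    subst (_≤ rowEnd a) r+[b-r]≡b (+-monoʳ-≤ r b-r≤lam)
    where
    r+[b-r]≡b : r + (b ∸ r) ≡ b
    r+[b-r]≡b = m+[n∸m]≡n (<⇒≤ r<b)

  record LeastRowStartingBefore (b x : ℕ) : Set where
    constructor leastRow
    field
      1≤row               : 1 ≤ x
      row≤r               : x ≤ r
      starts-before       : rowStart x < b
      earlier-start-later : ∀ {y} → 1 ≤ y → y < x → b ≤ rowStart y

  module _ {b x : ℕ} (least : LeastRowStartingBefore b x) where
    open LeastRowStartingBefore least

    leastRow-≤ : ∀ {a} → 1 ≤ a → rowStart a < b → x ≤ a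
    leastRow-≤ 1≤a a-start<b = ≮⇒≥ λ a<x → <⇒≱ a-start<b (earlier-start-later 1≤a a<x)

    leastRow-inShape : r < b → b ≤ size S → InShape S x b
    leastRow-inShape r<b b≤n with covering-row r<b b≤n
    ... | a , 1≤a , a≤r , a-start<b , b≤a-end =
      1≤row , row≤r , starts-before ,
      ≤-trans b≤a-end (rowEnd-antitone 1≤row row≤r (leastRow-≤ 1≤a a-start<b) a≤r)

  leastRow-unique : ∀ {b x x'} → LeastRowStartingBefore b x → LeastRowStartingBefore b x' → x ≡ x'
  leastRow-unique least@(leastRow 1≤x _ x-start<b _) least'@(leastRow 1≤x' _ x'-start<b _) =
    ≤-antisym (leastRow-≤ least 1≤x' x'-start<b) (leastRow-≤ least' 1≤x x-start<b)

  leastRow-exists : ∀ {b} → r < b → b ≤ size S → ∃ (LeastRowStartingBefore b)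
  leastRow-exists {b} r<b b≤n with covering-row r<b b≤n
  ... | a , 1≤a , a≤r , a-start<b , _
    with least-witness (λ x → (1 ≤? x) ×-dec (rowStart x <? b)) (1≤a , a-start<b)
  ... | x , x≤a , (1≤x , x-start<b) , earlier =
    x , leastRow 1≤x (≤-trans x≤a a≤r) x-start<b λ 1≤y y<x → ≮⇒≥ λ y-start<b → earlier y<x (1≤y , y-start<b)

  rowStart≤rowEnd-next : ∀ {i} → 1 ≤ i → suc i ≤ r → rowStart i ≤ rowEnd (suc i)
  rowStart≤rowEnd-next {i} 1≤i 1+i≤r with suc (rowEnd (suc i)) ≤? size S
  ... | no end≥n =
    ≤-trans (<⇒≤ (rowStart<rowEnd 1≤i i≤r)) (≤-trans (rowEnd≤n 1≤i i≤r) (s≤s⁻¹ (≰⇒> end≥n)))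
    where
    i≤r : i ≤ r
    i≤r = ≤-trans (n≤1+n i) 1+i≤r
  ... | yes end<n with covering-row (s≤s (m≤m+n r (lam (suc i)))) end<n
  ...   | a , 1≤a , a≤r , a-start≤end , end<a-end with suc i ≤? a
  ...     | yes 1+i≤a = ⊥-elim (<⇒≱ end<a-end (rowEnd-antitone (s≤s z≤n) 1+i≤r 1+i≤a a≤r))
  ...     | no 1+i≰a =
    ≤-trans (rowStart-antitone 1≤a (s≤s⁻¹ (≰⇒> 1+i≰a)) (≤-trans (n≤1+n i) 1+i≤r)) (s≤s⁻¹ a-start≤end)

  RowEndDescent : ℕ → ℕ → Set
  RowEndDescent a b = 2 ≤ a × a ≤ r × rowEnd a < rowEnd (a ∸ 1) × b ≡ suc (rowEnd a)

  outerCorner⇔rowEndDescent : ∀ {a b} → OuterCorner S a b ⇔ RowEndDescent a b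
  outerCorner⇔rowEndDescent = mk⇔ to from
    where
    to : ∀ {a b} → OuterCorner S a b → RowEndDescent a b
    to {zero}        (_ , _ , () , _)
    to {suc zero}    (_ , _ , () , _)
    to {suc (suc k)} {zero} (_ , (_ , _ , () , _) , _)
    to {suc (suc k)} {suc b} (∉ , (1≤a , a≤r , start<b , b≤end) , (_ , _ , _ , 1+b≤prev-end)) =
      s≤s (s≤s z≤n) , a≤r , <-≤-trans (s≤s end≤b) 1+b≤prev-end , cong suc (≤-antisym b≤end end≤b)
      where
      end≤b : rowEnd (suc (suc k)) ≤ b
      end≤b = ≮⇒≥ λ b<end → ∉ (1≤a , a≤r , m<n⇒m<1+n start<b , b<end)
    from : ∀ {a b} → RowEndDescent a b → OuterCorner S a b
    from {suc zero} (s≤s () , _)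
    from {suc (suc k)} (_ , a≤r , end<prev-end , refl) =
      (λ (_ , _ , _ , 1+end≤end) → 1+n≰n 1+end≤end) ,
      (s≤s z≤n , a≤r , rowStart<rowEnd (s≤s z≤n) a≤r , ≤-refl) ,
      (s≤s z≤n , ≤-trans (n≤1+n (suc k)) a≤r , s≤s (rowStart≤rowEnd-next (s≤s z≤n) a≤r) , end<prev-end)

  RowStartStep : ℕ → ℕ → Set
  RowStartStep a b = 1 ≤ a × LeastRowStartingBefore b (suc a) × rowStart a < suc b

  rowStartStep-b≤rowStart : ∀ {a b} → RowStartStep a b → b ≤ rowStart a
  rowStartStep-b≤rowStart (1≤a , leastRow _ _ _ earlier , _) = earlier 1≤a ≤-refl

  rowStartStep-r<b : ∀ {a b} → RowStartStep a b → r < b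
  rowStartStep-r<b {a} (_ , leastRow _ _ next-start<b _ , _) = ≤-<-trans (m≤m+n r (mu (suc a))) next-start<b

  rowStartStep-b<n : ∀ {a b} → RowStartStep a b → b < size S
  rowStartStep-b<n {a} step@(1≤a , leastRow _ 1+a≤r _ _ , _) =
    <-≤-trans (≤-<-trans (rowStartStep-b≤rowStart step) (rowStart<rowEnd 1≤a a≤r)) (rowEnd≤n 1≤a a≤r)
    where
    a≤r : a ≤ r
    a≤r = ≤-trans (n≤1+n a) 1+a≤r

  innerCorner⇔rowStartStep : ∀ {a b} → InnerCorner S a b ⇔ RowStartStep a b
  innerCorner⇔rowStartStep = mk⇔ to from
    where
    to : ∀ {a b} → InnerCorner S a b → RowStartStep a b
    to {a} {b} (∉ , (1≤1+a , 1+a≤r , next-start<b , _) , (1≤a , a≤r , start<1+b , 1+b≤end)) =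
      1≤a , leastRow 1≤1+a 1+a≤r next-start<b earlier , start<1+b
      where
      b≤start : b ≤ rowStart a
      b≤start = ≮⇒≥ λ start<b → ∉ (1≤a , a≤r , start<b , ≤-trans (n≤1+n b) 1+b≤end)
      earlier : ∀ {y} → 1 ≤ y → y < suc a → b ≤ rowStart y
      earlier 1≤y y<1+a = ≤-trans b≤start (rowStart-antitone 1≤y (s≤s⁻¹ y<1+a) a≤r)
    from : ∀ {a b} → RowStartStep a b → InnerCorner S a b
    from {a} step@(1≤a , least@(leastRow _ 1+a≤r _ _) , start<1+b) =
      (λ (_ , _ , start<b , _) → <⇒≱ start<b (rowStartStep-b≤rowStart step)) ,
      leastRow-inShape least (rowStartStep-r<b step) (<⇒≤ (rowStartStep-b<n step)) ,
      (1≤a , a≤r , start<1+b , ≤-<-trans (rowStartStep-b≤rowStart step) (rowStart<rowEnd 1≤a a≤r))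
      where
      a≤r : a ≤ r
      a≤r = ≤-trans (n≤1+n a) 1+a≤r

module Placements (S : SkewShape) where
  open SkewShape S

  Placement : Set
  Placement = List (ℕ × ℕ)

  Occupied : (ℕ × ℕ → ℕ) → Placement → ℕ → Set
  Occupied f ρ y = ∃[ p ] (p ∈ ρ × f p ≡ y)

  RowOccupied ColOccupied : Placement → ℕ → Set
  RowOccupied = Occupied proj₁
  ColOccupied = Occupied proj₂

  InBasis : Placement → ℕ → Set
  InBasis ρ x = OccRow S ρ x ⊎ UnoccCol S ρ x

  occupied? : ∀ f ρ y → Dec (Occupied f ρ y)
  occupied? f ρ y = map′ find (λ (_ , p∈ρ , fp≡y) → lose p∈ρ fp≡y) (any? (λ p → f p ≟ y) ρ)

  inBasis? : ∀ ρ x → Dec (InBasis ρ x)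
  inBasis? ρ x = ((1 ≤? x) ×-dec (x ≤? r) ×-dec occupied? proj₁ ρ x)
           ⊎-dec ((r <? x) ×-dec (x ≤? size S) ×-dec ¬? (occupied? proj₂ ρ x))

  basis : Placement → SubsetN S
  basis ρ x = does (inBasis? ρ x)

  basis≡true⇔ : ∀ {ρ x} → basis ρ x ≡ true ⇔ InBasis ρ x
  basis≡true⇔ {ρ} {x} = does≡true⇔ (inBasis? ρ x)

  basis-isBasis : ∀ {ρ} → NonNesting S ρ → IsBasis S (basis ρ)
  basis-isBasis nn = _ , nn , λ _ _ _ → basis≡true⇔

  inBasis-bounds : ∀ {ρ x} → InBasis ρ x → 1 ≤ x × x ≤ size S
  inBasis-bounds (inj₁ (1≤x , x≤r , _)) = 1≤x , ≤-trans x≤r (m≤m+n r c)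
  inBasis-bounds (inj₂ (r<x , x≤n , _)) = ≤-trans (s≤s z≤n) r<x , x≤n

  inBasis⇒rowOccupied : ∀ {ρ y} → y ≤ r → InBasis ρ y → RowOccupied ρ y
  inBasis⇒rowOccupied _   (inj₁ (_ , _ , occupied)) = occupied
  inBasis⇒rowOccupied y≤r (inj₂ (r<y , _)) = ⊥-elim (<⇒≱ r<y y≤r)

  inBasis⇒colFree : ∀ {ρ y} → r < y → InBasis ρ y → ¬ ColOccupied ρ y
  inBasis⇒colFree r<y (inj₁ (_ , y≤r , _)) = ⊥-elim (<⇒≱ r<y y≤r)
  inBasis⇒colFree _   (inj₂ (_ , _ , free)) = free

  inBasis-cong : ∀ {ρ ρ' y} →
                 (1 ≤ y → y ≤ r → RowOccupied ρ y ⇔ RowOccupied ρ' y) →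
                 (r < y → y ≤ size S → ColOccupied ρ y ⇔ ColOccupied ρ' y) →
                 InBasis ρ y ⇔ InBasis ρ' y
  inBasis-cong rows cols =
    mk⇔ (transfer rows cols) (transfer (λ a b → ⇔-sym (rows a b)) (λ a b → ⇔-sym (cols a b)))
    where
    transfer : ∀ {ρ ρ' y} → (1 ≤ y → y ≤ r → RowOccupied ρ y ⇔ RowOccupied ρ' y) →
               (r < y → y ≤ size S → ColOccupied ρ y ⇔ ColOccupied ρ' y) → InBasis ρ y → InBasis ρ' y
    transfer rows _ (inj₁ (1≤y , y≤r , occ)) = inj₁ (1≤y , y≤r , Equivalence.to (rows 1≤y y≤r) occ)
    transfer _ cols (inj₂ (r<y , y≤n , free)) =
      inj₂ (r<y , y≤n , λ occ → free (Equivalence.from (cols r<y y≤n) occ))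

  occupied-filter⇔ : ∀ f {P : ℕ × ℕ → Set} (P? : Decidable P) {ρ y} →
                     (∀ {p} → p ∈ ρ → f p ≡ y → P p) → Occupied f ρ y ⇔ Occupied f (filter P? ρ) y
  occupied-filter⇔ f P? kept = mk⇔
    (λ (p , p∈ρ , fp≡y) → p , ∈-filter⁺ P? p∈ρ (kept p∈ρ fp≡y) , fp≡y)
    (λ (p , p∈ρ' , fp≡y) → p , proj₁ (∈-filter⁻ P? p∈ρ') , fp≡y)

  occupied-∷⇔ : ∀ f {p ρ y} → f p ≢ y → Occupied f (p ∷ ρ) y ⇔ Occupied f ρ y
  occupied-∷⇔ f fp≢y = mk⇔
    (λ { (_ , here refl , fp≡y) → ⊥-elim (fp≢y fp≡y) ; (q , there q∈ρ , fq≡y) → q , q∈ρ , fq≡y })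
    (λ (q , q∈ρ , fq≡y) → q , there q∈ρ , fq≡y)

  module _ {ρ} (nn : NonNesting S ρ) where

    rook-inShape : ∀ {a b} → (a , b) ∈ ρ → InShape S a b
    rook-inShape = proj₁ nn _

    rooks-sameRow : ∀ {p q} → p ∈ ρ → q ∈ ρ → proj₁ p ≡ proj₁ q → p ≡ q
    rooks-sameRow p∈ρ q∈ρ eq = proj₁ (proj₂ nn) _ _ p∈ρ q∈ρ (inj₁ eq)

    rooks-sameCol : ∀ {p q} → p ∈ ρ → q ∈ ρ → proj₂ p ≡ proj₂ q → p ≡ q
    rooks-sameCol p∈ρ q∈ρ eq = proj₁ (proj₂ nn) _ _ p∈ρ q∈ρ (inj₂ eq)

    rooks-unnested : ∀ {p q} → p ∈ ρ → q ∈ ρ → ¬ (proj₁ p < proj₁ q × proj₂ p < proj₂ q)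
    rooks-unnested = proj₂ (proj₂ nn) _ _

  nonNesting-⊆ : ∀ {ρ ρ'} → ρ' ⊆ ρ → NonNesting S ρ → NonNesting S ρ'
  nonNesting-⊆ ρ'⊆ρ (inShape , sameLine , unnested) =
    (λ p p∈ → inShape p (ρ'⊆ρ p∈)) ,
    (λ p q p∈ q∈ → sameLine p q (ρ'⊆ρ p∈) (ρ'⊆ρ q∈)) ,
    (λ p q p∈ q∈ → unnested p q (ρ'⊆ρ p∈) (ρ'⊆ρ q∈))

  Compatible : ℕ × ℕ → ℕ × ℕ → Set
  Compatible (a , b) (a' , b') = a' ≢ a × b' ≢ b × ¬ (a < a' × b < b') × ¬ (a' < a × b' < b)

  nonNesting-∷ : ∀ {a b ρ} → InShape S a b → NonNesting S ρ → (∀ {p} → p ∈ ρ → Compatible (a , b) p) →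
                 NonNesting S ((a , b) ∷ ρ)
  nonNesting-∷ {a} {b} {ρ} ab∈S (inShape , sameLine , unnested) compatible =
    inShape′ , sameLine′ , unnested′
    where
    inShape′ : ∀ p → p ∈ (a , b) ∷ ρ → InShape S (proj₁ p) (proj₂ p)
    inShape′ _ (here refl) = ab∈S
    inShape′ p (there p∈ρ) = inShape p p∈ρ
    sameLine′ : ∀ p q → p ∈ (a , b) ∷ ρ → q ∈ (a , b) ∷ ρ →
                proj₁ p ≡ proj₁ q ⊎ proj₂ p ≡ proj₂ q → p ≡ q
    sameLine′ _ _ (here refl) (here refl) _ = refl
    sameLine′ _ _ (here refl) (there q∈ρ) (inj₁ eq) = ⊥-elim (proj₁ (compatible q∈ρ) (sym eq))
    sameLine′ _ _ (here refl) (there q∈ρ) (inj₂ eq) = ⊥-elim (proj₁ (proj₂ (compatible q∈ρ)) (sym eq))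
    sameLine′ _ _ (there p∈ρ) (here refl) (inj₁ eq) = ⊥-elim (proj₁ (compatible p∈ρ) eq)
    sameLine′ _ _ (there p∈ρ) (here refl) (inj₂ eq) = ⊥-elim (proj₁ (proj₂ (compatible p∈ρ)) eq)
    sameLine′ p q (there p∈ρ) (there q∈ρ) eq = sameLine p q p∈ρ q∈ρ eq
    unnested′ : ∀ p q → p ∈ (a , b) ∷ ρ → q ∈ (a , b) ∷ ρ → ¬ (proj₁ p < proj₁ q × proj₂ p < proj₂ q)
    unnested′ _ _ (here refl) (here refl) (a<a , _) = <-irrefl refl a<a
    unnested′ _ _ (here refl) (there q∈ρ) = proj₁ (proj₂ (proj₂ (compatible q∈ρ)))
    unnested′ _ _ (there p∈ρ) (here refl) = proj₂ (proj₂ (proj₂ (compatible p∈ρ)))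
    unnested′ p q (there p∈ρ) (there q∈ρ) = unnested p q p∈ρ q∈ρ

IsLexMinBasis : (S : SkewShape) → ℕ → SubsetN S → Set
IsLexMinBasis S i B =
  IsBasis S B × (∀ B' → IsBasis S B' → LexLe (Lt i) (sortedIn (size S) i B) (sortedIn (size S) i B'))

module LexMin (S : SkewShape) {i : ℕ} (1≤i : 1 ≤ i) (i≤n : i ≤ size S)
              {B : SubsetN S} (lexMin : IsLexMinBasis S i B) where
  open SkewShape S
  open Shape S
  open Placements S

  ρ : Placement
  ρ = proj₁ (proj₁ lexMin)

  ρ-nonNesting : NonNesting S ρ
  ρ-nonNesting = proj₁ (proj₂ (proj₁ lexMin))

  B≡true⇔ : ∀ {x} → 1 ≤ x → x ≤ size S → B x ≡ true ⇔ InBasis ρ x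
  B≡true⇔ = proj₂ (proj₂ (proj₁ lexMin)) _

  B≡true : ∀ {x} → InBasis ρ x → B x ≡ true
  B≡true x∈ρ = Equivalence.from (B≡true⇔ (proj₁ (inBasis-bounds x∈ρ)) (proj₂ (inBasis-bounds x∈ρ))) x∈ρ

  B≡false : ∀ {x} → 1 ≤ x → x ≤ size S → ¬ InBasis ρ x → B x ≡ false
  B≡false 1≤x x≤n x∉ρ = ¬-not (λ Bx → x∉ρ (Equivalence.to (B≡true⇔ 1≤x x≤n) Bx))

  -- The basis of such a ρ' would be lexicographically smaller than B.
  ¬improvement : ∀ {ρ' x z} → NonNesting S ρ' → Lt i x z →
                 (∀ {y} → 1 ≤ y → y ≤ size S → Lt i y x → InBasis ρ y ⇔ InBasis ρ' y) →
                 ¬ InBasis ρ x → InBasis ρ' x → InBasis ρ z → ⊥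
  ¬improvement {ρ'} {x} nn' x<z agree x∉ρ x∈ρ' z∈ρ
    with inBasis-bounds x∈ρ' | inBasis-bounds z∈ρ
  ... | 1≤x , x≤n | 1≤z , z≤size =
    select-¬LexLe Lt-asym (cycOrder-sorted (size S) 1≤i) B (basis ρ')
      (∈-cycOrder⁺ {i = i} 1≤x x≤n) (∈-cycOrder⁺ {i = i} 1≤z z≤size) x<z agree-B
      (B≡false 1≤x x≤n x∉ρ) (Equivalence.from basis≡true⇔ x∈ρ') (B≡true z∈ρ)
      (proj₂ lexMin (basis ρ') (basis-isBasis nn'))
    where
    agree-B : ∀ {y} → y ∈ cycOrder (size S) i → Lt i y x → B y ≡ basis ρ' y
    agree-B y∈ y<x with ∈-cycOrder⁻ 1≤i i≤n y∈
    ... | 1≤y , y≤n =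
      ≡true⇔⇒≡ (⇔-trans (B≡true⇔ 1≤y y≤n) (⇔-trans (agree 1≤y y≤n y<x) (⇔-sym basis≡true⇔)))

  rook-¬column<row : ∀ {a y} → (a , y) ∈ ρ → ¬ Lt i y a
  rook-¬column<row {a} {y} ay∈ρ y<a =
    ¬improvement (nonNesting-⊆ (filter-⊆ other? ρ) ρ-nonNesting) y<a agree y∉ρ y∈ρ' a∈ρ
    where
    other? : Decidable (_≢ (a , y))
    other? p = ¬? (≡-dec _≟_ _≟_ p (a , y))
    ρ' : Placement
    ρ' = filter other? ρ
    ay∈S : InShape S a y
    ay∈S = rook-inShape ρ-nonNesting ay∈ρ
    r<y : r < y
    r<y = inShape-r< ay∈S
    y∉ρ : ¬ InBasis ρ y
    y∉ρ y∈ρ = inBasis⇒colFree r<y y∈ρ (_ , ay∈ρ , refl)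
    y∈ρ' : InBasis ρ' y
    y∈ρ' = inj₂ (r<y , inShape-≤n ay∈S , λ (p , p∈ρ' , p₂≡y) →
      let (p∈ρ , p≢ay) = ∈-filter⁻ other? p∈ρ' in p≢ay (rooks-sameCol ρ-nonNesting p∈ρ ay∈ρ p₂≡y))
    a∈ρ : InBasis ρ a
    a∈ρ = inj₁ (proj₁ ay∈S , proj₁ (proj₂ ay∈S) , _ , ay∈ρ , refl)
    agree : ∀ {y'} → 1 ≤ y' → y' ≤ size S → Lt i y' y → InBasis ρ y' ⇔ InBasis ρ' y'
    agree {y'} _ _ y'<y = inBasis-cong
      (λ _ _ → occupied-filter⇔ proj₁ other? λ { _ refl refl → Lt-asym y<a y'<y })
      (λ _ _ → occupied-filter⇔ proj₂ other? λ { _ refl refl → Lt-irrefl y'<y })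

  rook-row<start⇒col<start : ∀ {a y} → (a , y) ∈ ρ → a < i → y < i
  rook-row<start⇒col<start ay∈ρ a<i = ≰⇒> λ i≤y → rook-¬column<row ay∈ρ (inj₂ (inj₂ (i≤y , a<i)))

module LexMinAtRow (S : SkewShape) {i : ℕ} (1≤i : 1 ≤ i) (i≤r : i ≤ SkewShape.r S)
                   {B : SubsetN S} (lexMin : IsLexMinBasis S i B) where
  open SkewShape S
  open Shape S
  open Placements S
  open LexMin S 1≤i (≤-trans i≤r (m≤m+n r c)) lexMin

  rook-col≤rowEnd : ∀ {a y} → (a , y) ∈ ρ → y ≤ rowEnd i
  rook-col≤rowEnd {a} ay∈ρ with rook-inShape ρ-nonNesting ay∈ρ | i ≤? a
  ... | _ , a≤r , _ , y≤end | yes i≤a = ≤-trans y≤end (rowEnd-antitone 1≤i i≤r i≤a a≤r)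
  ... | ay∈S | no i≰a =
    ⊥-elim (<⇒≱ (rook-row<start⇒col<start ay∈ρ (≰⇒> i≰a)) (≤-trans i≤r (<⇒≤ (inShape-r< ay∈S))))

  r<rowEnd : r < rowEnd i
  r<rowEnd = ≤-<-trans (m≤m+n r (mu i)) (rowStart<rowEnd 1≤i i≤r)

  B-right-of-rowEnd : ∀ {y} → rowEnd i < y → y ≤ size S → B y ≡ true
  B-right-of-rowEnd end<y y≤n =
    B≡true (inj₂ (<-trans r<rowEnd end<y , y≤n , λ { (_ , ay∈ρ , refl) → <⇒≱ end<y (rook-col≤rowEnd ay∈ρ) }))

  private module RowEndFree (free : ¬ ColOccupied ρ (rowEnd i)) where

    later? : Decidable (λ (p : ℕ × ℕ) → i < proj₁ p)
    later? p = i <? proj₁ p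

    ρ' : Placement
    ρ' = (i , rowEnd i) ∷ filter later? ρ

    ρ'-nonNesting : NonNesting S ρ'
    ρ'-nonNesting = nonNesting-∷ (1≤i , i≤r , rowStart<rowEnd 1≤i i≤r , ≤-refl)
                                 (nonNesting-⊆ (filter-⊆ later? ρ) ρ-nonNesting) compatible
      where
      compatible : ∀ {p} → p ∈ filter later? ρ → Compatible (i , rowEnd i) p
      compatible p∈ρ' with ∈-filter⁻ later? p∈ρ'
      ... | ay∈ρ , i<a =
        (λ a≡i → <-irrefl (sym a≡i) i<a) , (λ y≡end → free (_ , ay∈ρ , y≡end)) ,
        (λ (_ , end<y) → <⇒≱ end<y (rook-col≤rowEnd ay∈ρ)) , (λ (a<i , _) → <-asym a<i i<a)

    rowEnd∈ρ : InBasis ρ (rowEnd i)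
    rowEnd∈ρ = inj₂ (r<rowEnd , rowEnd≤n 1≤i i≤r , free)

    row-free-impossible : ¬ RowOccupied ρ i → ⊥
    row-free-impossible row-free =
      ¬improvement ρ'-nonNesting (inj₁ (≤-refl , ≤-trans i≤r (<⇒≤ r<rowEnd) , ≤-<-trans i≤r r<rowEnd))
        (λ _ _ y<i → ⊥-elim (¬Lt-start y<i)) (λ i∈ρ → row-free (inBasis⇒rowOccupied i≤r i∈ρ))
        (inj₁ (1≤i , i≤r , _ , here refl , refl)) rowEnd∈ρ

    module _ {b : ℕ} (ib∈ρ : (i , b) ∈ ρ) where

      r<b : r < b
      r<b = inShape-r< (rook-inShape ρ-nonNesting ib∈ρ)

      b<rowEnd : b < rowEnd i
      b<rowEnd with rook-inShape ρ-nonNesting ib∈ρ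
      ... | _ , _ , _ , b≤end = ≤∧≢⇒< b≤end λ b≡end → free (_ , ib∈ρ , b≡end)

      b∈ρ' : InBasis ρ' b
      b∈ρ' = inj₂ (r<b , inShape-≤n (rook-inShape ρ-nonNesting ib∈ρ) , λ
        { (_ , here refl , end≡b) → <-irrefl (sym end≡b) b<rowEnd
        ; (p , there p∈ρ' , p₂≡b) → let (p∈ρ , i<p₁) = ∈-filter⁻ later? p∈ρ' in
            <-irrefl (sym (cong proj₁ (rooks-sameCol ρ-nonNesting p∈ρ ib∈ρ p₂≡b))) i<p₁ })

      rows-agree : ∀ {y} → i ≤ y → RowOccupied ρ y ⇔ RowOccupied ρ' y
      rows-agree {y} i≤y with i ≟ y
      ... | yes refl = mk⇔ (λ _ → _ , here refl , refl) (λ _ → _ , ib∈ρ , refl)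
      ... | no i≢y = ⇔-trans (occupied-filter⇔ proj₁ later? λ { _ refl → ≤∧≢⇒< i≤y i≢y })
                             (⇔-sym (occupied-∷⇔ proj₁ i≢y))

      cols-agree : ∀ {y} → y < b → ColOccupied ρ y ⇔ ColOccupied ρ' y
      cols-agree {y} y<b =
        ⇔-trans (occupied-filter⇔ proj₂ later? later-if-left-of-b)
                (⇔-sym (occupied-∷⇔ proj₂ λ end≡y → <-asym b<rowEnd (subst (_< b) (sym end≡y) y<b)))
        where
        later-if-left-of-b : ∀ {p} → p ∈ ρ → proj₂ p ≡ y → i < proj₁ p
        later-if-left-of-b {a , _} p∈ρ refl with <-cmp a i
        ... | tri< a<i _ _  = ⊥-elim (rooks-unnested ρ-nonNesting p∈ρ ib∈ρ (a<i , y<b))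
        ... | tri≈ _ refl _ = ⊥-elim (<-irrefl (cong proj₂ (rooks-sameRow ρ-nonNesting p∈ρ ib∈ρ refl)) y<b)
        ... | tri> _ _ i<a  = i<a

      row-occupied-impossible : ⊥
      row-occupied-impossible =
        ¬improvement ρ'-nonNesting (inj₁ (i≤b , ≤-trans i≤r (<⇒≤ r<rowEnd) , b<rowEnd)) agree
          (λ b∈ρ → inBasis⇒colFree r<b b∈ρ (_ , ib∈ρ , refl)) b∈ρ' rowEnd∈ρ
        where
        i≤b : i ≤ b
        i≤b = ≤-trans i≤r (<⇒≤ r<b)
        agree : ∀ {y} → 1 ≤ y → y ≤ size S → Lt i y b → InBasis ρ y ⇔ InBasis ρ' y
        agree _ _ (inj₁ (i≤y , _ , y<b))      = inBasis-cong (λ _ _ → rows-agree i≤y) (λ _ _ → cols-agree y<b)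
        agree _ _ (inj₂ (inj₁ (_ , b<i , _))) = ⊥-elim (<⇒≱ b<i i≤b)
        agree _ _ (inj₂ (inj₂ (_ , b<i)))     = ⊥-elim (<⇒≱ b<i i≤b)

    impossible : ⊥
    impossible with occupied? proj₁ ρ i
    ... | no row-free = row-free-impossible row-free
    ... | yes (_ , ib∈ρ , refl) = row-occupied-impossible ib∈ρ

  B-rowEnd : B (rowEnd i) ≡ false
  B-rowEnd = B≡false (≤-trans (s≤s z≤n) r<rowEnd) (rowEnd≤n 1≤i i≤r) λ end∈ρ →
    RowEndFree.impossible (inBasis⇒colFree r<rowEnd end∈ρ)

  max-column-outside-B : foldr _⊔_ 0 (select (λ x → not (B x)) (interval (suc r) (size S))) ≡ rowEnd i
  max-column-outside-B = foldr-⊔-≡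
    (∈-filter⁺ outside? (∈-interval⁺ r<rowEnd (rowEnd≤n 1≤i i≤r)) (subst (λ b → T (not b)) (sym B-rowEnd) tt))
    (All.tabulate λ y∈ → let (y∈cols , y∉B) = ∈-filter⁻ outside? {xs = interval (suc r) (size S)} y∈ in
      ≮⇒≥ λ end<y → subst (λ b → T (not b)) (B-right-of-rowEnd end<y (proj₂ (∈-interval⁻ y∈cols))) y∉B)
    where
    outside? : Decidable (λ x → T (not (B x)))
    outside? x = T? (not (B x))

-- The necklace index is j = suc b, so that b is the column j - 1 of the inner corner.
module LexMinAtColumn (S : SkewShape) {b : ℕ} (r<b : SkewShape.r S < b) (b<n : b < size S)
                      {B : SubsetN S} (lexMin : IsLexMinBasis S (suc b) B) where
  open SkewShape S
  open Shape S
  open Placements S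
  open LexMin S (s≤s z≤n) b<n lexMin

  rook-col≤b : ∀ {a y} → (a , y) ∈ ρ → y ≤ b
  rook-col≤b ay∈ρ with rook-inShape ρ-nonNesting ay∈ρ
  ... | _ , a≤r , _ = s≤s⁻¹ (rook-row<start⇒col<start ay∈ρ (s≤s (≤-trans a≤r (<⇒≤ r<b))))

  module _ {x : ℕ} (least : LeastRowStartingBefore b x) where
    open LeastRowStartingBefore least
      renaming (1≤row to 1≤x; row≤r to x≤r; starts-before to x-start<b; earlier-start-later to earlier)

    rook-row≥least : ∀ {a y} → (a , y) ∈ ρ → x ≤ a
    rook-row≥least ay∈ρ with rook-inShape ρ-nonNesting ay∈ρ
    ... | 1≤a , _ , a-start<y , _ =
      ≮⇒≥ λ a<x → <⇒≱ (≤-<-trans (earlier 1≤a a<x) a-start<y) (rook-col≤b ay∈ρ)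

    B-above-least : ∀ {y} → 1 ≤ y → y < x → B y ≡ false
    B-above-least {y} 1≤y y<x = B≡false 1≤y (≤-trans y≤r (m≤m+n r c)) λ y∈ρ →
      case inBasis⇒rowOccupied y≤r y∈ρ of λ { (_ , ay∈ρ , refl) → <⇒≱ y<x (rook-row≥least ay∈ρ) }
      where
      y≤r : y ≤ r
      y≤r = ≤-trans (<⇒≤ y<x) x≤r

    private module LeastRowFree (free : ¬ RowOccupied ρ x) where

      rook-below-least : ∀ {a y} → (a , y) ∈ ρ → x < a
      rook-below-least ay∈ρ = ≤∧≢⇒< (rook-row≥least ay∈ρ) λ { refl → free (_ , ay∈ρ , refl) }

      left? : Decidable (λ (p : ℕ × ℕ) → proj₂ p < suc (rowStart x))
      left? p = proj₂ p <? suc (rowStart x)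

      ρ' : Placement
      ρ' = (x , suc (rowStart x)) ∷ filter left? ρ

      ρ'-nonNesting : NonNesting S ρ'
      ρ'-nonNesting = nonNesting-∷ (1≤x , x≤r , ≤-refl , rowStart<rowEnd 1≤x x≤r)
                                   (nonNesting-⊆ (filter-⊆ left? ρ) ρ-nonNesting) compatible
        where
        compatible : ∀ {p} → p ∈ filter left? ρ → Compatible (x , suc (rowStart x)) p
        compatible p∈ρ' with ∈-filter⁻ left? p∈ρ'
        ... | ay∈ρ , y<start =
          (λ { refl → <-irrefl refl (rook-below-least ay∈ρ) }) , (λ { refl → <-irrefl refl y<start }) ,
          (λ (_ , start<y) → <-asym start<y y<start) , (λ (a<x , _) → <-asym a<x (rook-below-least ay∈ρ))

      x<b : x < suc b
      x<b = s≤s (≤-trans x≤r (<⇒≤ r<b))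

      later-in-ρ : ∃[ z ] (Lt (suc b) x z × InBasis ρ z)
      later-in-ρ with occupied? proj₂ ρ (suc r)
      ... | no col-free =
        suc r , inj₂ (inj₁ (x<b , s≤s r<b , s≤s x≤r)) , inj₂ (≤-refl , ≤-trans r<b (<⇒≤ b<n) , col-free)
      ... | yes ((a , _) , ay∈ρ , _) with rook-inShape ρ-nonNesting ay∈ρ
      ...   | 1≤a , a≤r , _ =
        a , inj₂ (inj₁ (x<b , s≤s (≤-trans a≤r (<⇒≤ r<b)) , rook-below-least ay∈ρ)) ,
        inj₁ (1≤a , a≤r , _ , ay∈ρ , refl)

      unoccupied-in-both : ∀ f {y} → (∀ {p} → p ∈ ρ → f p ≢ y) → f (x , suc (rowStart x)) ≢ y →
                           Occupied f ρ y ⇔ Occupied f ρ' y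
      unoccupied-in-both f ρ-free new≢y =
        ⇔-trans (occupied-filter⇔ f left? λ p∈ρ fp≡y → ⊥-elim (ρ-free p∈ρ fp≡y)) (⇔-sym (occupied-∷⇔ f new≢y))

      agree : ∀ {y} → 1 ≤ y → y ≤ size S → Lt (suc b) y x → InBasis ρ y ⇔ InBasis ρ' y
      agree _ _ (inj₁ (_ , b<x , _)) = ⊥-elim (<⇒≱ x<b b<x)
      agree _ _ (inj₂ (inj₁ (_ , _ , y<x))) = inBasis-cong
        (λ _ _ → unoccupied-in-both proj₁ (λ { ay∈ρ refl → <-asym y<x (rook-below-least ay∈ρ) })
                                          (λ { refl → <-irrefl refl y<x }))
        (λ r<y _ → ⊥-elim (<⇒≱ r<y (≤-trans (<⇒≤ y<x) x≤r)))
      agree _ _ (inj₂ (inj₂ (b<y , _))) = inBasis-cong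
        (λ _ y≤r → ⊥-elim (<-asym (≤-<-trans y≤r r<b) b<y))
        (λ _ _ → unoccupied-in-both proj₂ (λ { ay∈ρ refl → <⇒≱ b<y (rook-col≤b ay∈ρ) })
                                          (λ { refl → <⇒≱ b<y x-start<b }))

      impossible : ⊥
      impossible with later-in-ρ
      ... | z , x<z , z∈ρ = ¬improvement ρ'-nonNesting x<z agree
        (λ x∈ρ → free (inBasis⇒rowOccupied x≤r x∈ρ)) (inj₁ (1≤x , x≤r , _ , here refl , refl)) z∈ρ

    B-least : B x ≡ true
    B-least with occupied? proj₁ ρ x
    ... | yes occupied = B≡true (inj₁ (1≤x , x≤r , occupied))
    ... | no free = ⊥-elim (LeastRowFree.impossible free)

    first-row-in-B : headOr0 S (select B (interval 1 r)) ≡ x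
    first-row-in-B with select-first B (interval-pairs 1 r λ _ y<y' _ → y<y') (∈-interval⁺ 1≤x x≤r) B-least
                          (λ y∈ y<x → B-above-least (proj₁ (∈-interval⁻ y∈)) y<x)
    ... | _ , starts-with-x = cong (headOr0 S) starts-with-x

module Necklace (S : SkewShape) (I : NecklaceCandidate S) (necklace : IsGrassmannNecklace S I) where
  open SkewShape S
  open Shape S

  cc≡rowEnd : ∀ {i} → 1 ≤ i → i ≤ r → cc S I i ≡ rowEnd i
  cc≡rowEnd 1≤i i≤r =
    LexMinAtRow.max-column-outside-B S 1≤i i≤r (necklace _ 1≤i (≤-trans i≤r (m≤m+n r c)))

  rr-within : ∀ {j} → j ≤ size S → rr S I j ≡ headOr0 S (select (I j) (interval 1 r))
  rr-within {j} j≤n with size S <? j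
  ... | yes n<j = ⊥-elim (<⇒≱ n<j j≤n)
  ... | no _    = refl

  rr-beyond : ∀ {j} → size S < j → rr S I j ≡ 0
  rr-beyond {j} n<j with size S <? j
  ... | yes _   = refl
  ... | no n≮j = ⊥-elim (n≮j n<j)

  rr-least : ∀ {b} → r < b → b < size S → LeastRowStartingBefore b (rr S I (suc b))
  rr-least {b} r<b b<n with leastRow-exists r<b (<⇒≤ b<n)
  ... | x , least = subst (LeastRowStartingBefore b) (sym rr≡x) least
    where
    rr≡x : rr S I (suc b) ≡ x
    rr≡x = trans (rr-within b<n)
                 (LexMinAtColumn.first-row-in-B S r<b b<n (necklace (suc b) (s≤s z≤n) b<n) least)

  rr≤⇔rowStart< : ∀ {b x} → r < b → b ≤ size S → 1 ≤ x → x ≤ r → rr S I (suc b) ≤ x ⇔ rowStart x < b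
  rr≤⇔rowStart< {b} r<b b≤n 1≤x x≤r with m≤n⇒m<n∨m≡n b≤n
  ... | inj₁ b<n with rr-least r<b b<n
  ...   | least@(leastRow 1≤rr _ rr-start<b _) =
    mk⇔ (λ rr≤x → ≤-<-trans (rowStart-antitone 1≤rr rr≤x x≤r) rr-start<b) (leastRow-≤ least 1≤x)
  rr≤⇔rowStart< r<b b≤n 1≤x x≤r | inj₂ refl =
    mk⇔ (λ _ → <-≤-trans (rowStart<rowEnd 1≤x x≤r) (rowEnd≤n 1≤x x≤r))
        (λ _ → subst (_≤ _) (sym (rr-beyond ≤-refl)) z≤n)

  inOC⇔rowEndDescent : ∀ {a b} → InOC S I a b ⇔ RowEndDescent a b
  inOC⇔rowEndDescent = mk⇔ to from
    where
    to : ∀ {a b} → InOC S I a b → RowEndDescent a b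
    to (suc zero , s≤s () , _)
    to (suc (suc k) , 2≤i , i≤r , c<c' , refl , refl)
      rewrite cc≡rowEnd (s≤s z≤n) i≤r | cc≡rowEnd (s≤s z≤n) (≤-trans (n≤1+n (suc k)) i≤r) =
      2≤i , i≤r , c<c' , +-comm _ 1
    from : ∀ {a b} → RowEndDescent a b → InOC S I a b
    from {suc zero} (s≤s () , _)
    from {suc (suc k)} (2≤a , a≤r , end<end' , refl) =
      suc (suc k) , 2≤a , a≤r ,
      subst₂ _<_ (sym (cc≡rowEnd (s≤s z≤n) a≤r))
                 (sym (cc≡rowEnd (s≤s z≤n) (≤-trans (n≤1+n (suc k)) a≤r))) end<end' ,
      refl , trans (+-comm 1 _) (cong (_+ 1) (sym (cc≡rowEnd (s≤s z≤n) a≤r)))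

  inIC⇔rowStartStep : ∀ {a b} → InIC S I a b ⇔ RowStartStep a b
  inIC⇔rowStartStep = mk⇔ to from
    where
    to : ∀ {a b} → InIC S I a b → RowStartStep a b
    to (suc b , s≤s r<b , b<n , next<rr , rr≢1 , refl , refl)
      with rr S I (suc b) | rr-least r<b b<n | next<rr | rr≢1
    ... | suc zero | _ | _ | ≢1 = ⊥-elim (≢1 refl)
    ... | suc (suc a) | least@(leastRow _ 2+a≤r _ _) | next<2+a | _ =
      s≤s z≤n , least ,
      Equivalence.to (rr≤⇔rowStart< (m<n⇒m<1+n r<b) b<n (s≤s z≤n) (≤-trans (n≤1+n _) 2+a≤r)) (s≤s⁻¹ next<2+a)
    from : ∀ {a b} → RowStartStep a b → InIC S I a b
    from {a} {b} step@(1≤a , least@(leastRow _ 1+a≤r _ _) , start<1+b) =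
      suc b , s≤s r<b , b<n , next<rr , rr≢1 , cong (_∸ 1) (sym rr≡1+a) , refl
      where
      r<b : r < b
      r<b = rowStartStep-r<b step
      b<n : b < size S
      b<n = rowStartStep-b<n step
      rr≡1+a : rr S I (suc b) ≡ suc a
      rr≡1+a = leastRow-unique (rr-least r<b b<n) least
      next<rr : rr S I (suc (suc b)) < rr S I (suc b)
      next<rr rewrite rr≡1+a =
        s≤s (Equivalence.from (rr≤⇔rowStart< (m<n⇒m<1+n r<b) b<n 1≤a (≤-trans (n≤1+n a) 1+a≤r)) start<1+b)
      rr≢1 : rr S I (suc b) ≢ 1
      rr≢1 rr≡1 = <-irrefl (sym (suc-injective (trans (sym rr≡1+a) rr≡1))) 1≤a

corollary3p30 : (S : SkewShape) → (I : NecklaceCandidate S) → IsGrassmannNecklace S I →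
    (∀ a b → (InIC S I a b ⇔ InnerCorner S a b)) ×
    (∀ a b → (InOC S I a b ⇔ OuterCorner S a b))
corollary3p30 S I necklace =
  (λ _ _ → ⇔-trans inIC⇔rowStartStep (⇔-sym innerCorner⇔rowStartStep)) ,
  (λ _ _ → ⇔-trans inOC⇔rowEndDescent (⇔-sym outerCorner⇔rowEndDescent))
  where
  open Shape S
  open Necklace S I necklace
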